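{- Let $G$ be a $2$-connected $S_{2,2}$-free outerplanar graph with $n\ge 6$ vertices. Then $|E(G)|\le \left\lfloor\frac{5n}{4}\right\rfloor$.
   Context: All graphs are finite, simple and undirected. The double star $S_{2,2}$ is the graph obtained from an edge $xy$ by joining each of $x$ and $y$ to two new vertices. A graph is $S_{2,2}$-free if it contains no subgraph isomorphic to $S_{2,2}$. A graph is outerplanar if it has a planar embedding with all vertices on the boundary of the outer face. -}

module Defs where

open import Data.Nat using (ℕ; _+_; _<_; _≤_)
open import Data.Nat.Base using (_<ᵇ_)
open import Data.Bool using (Bool; true; false; if_then_else_; _∧_)
open import Data.Fin using (Fin; toℕ; #_)
open import Data.List using (List; map; allFin)
open import Data.Nat.ListAction using (sum)
open import Data.Product using (Σ; _×_; ∃)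
open import Data.Unit using (⊤)
open import Data.Empty using (⊥)
open import Relation.Nullary using (¬_)
open import Relation.Binary.PropositionalEquality using (_≡_; _≢_)
open import Function.Definitions using (Injective)

record Graph (n : ℕ) : Set where
  field
    adj    : Fin n → Fin n → Bool
    sym    : ∀ i j → adj i j ≡ adj j i
    irrefl : ∀ i → adj i i ≡ false
open Graph public

edgeCount : ∀ {n} → Graph n → ℕ
edgeCount {n} G =
  sum (map (λ i → sum (map (λ j → if (toℕ i <ᵇ toℕ j) ∧ adj G i j then 1 else 0)
                             (allFin n)))
           (allFin n))

-- Walks in G whose vertices after the start all satisfy P.
data Reach {n : ℕ} (G : Graph n) (P : Fin n → Set) : Fin n → Fin n → Set where
  here : ∀ {u} → Reach G P u u
  step : ∀ {u v w} → adj G u v ≡ true → P v → Reach G P v w → Reach G P u w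

Connected : ∀ {n} → Graph n → Set
Connected G = ∀ u v → Reach G (λ _ → ⊤) u v

TwoConnected : ∀ {n} → Graph n → Set
TwoConnected {n} G =
  (3 ≤ n) × Connected G ×
  (∀ w u v → u ≢ w → v ≢ w → Reach G (λ x → x ≢ w) u v)

-- G contains S_{2,2} as a (not necessarily induced) subgraph:
-- distinct vertices f0 (= x), f1 (= y), with x ~ y, x ~ f2, x ~ f3, y ~ f4, y ~ f5.
ContainsS22 : ∀ {n} → Graph n → Set
ContainsS22 {n} G =
  Σ (Fin 6 → Fin n) λ f → Injective _≡_ _≡_ f ×
    (adj G (f (# 0)) (f (# 1)) ≡ true) × (adj G (f (# 0)) (f (# 2)) ≡ true) ×
    (adj G (f (# 0)) (f (# 3)) ≡ true) × (adj G (f (# 1)) (f (# 4)) ≡ true) ×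
    (adj G (f (# 1)) (f (# 5)) ≡ true)

S22Free : ∀ {n} → Graph n → Set
S22Free G = ¬ ContainsS22 G

-- Outerplanar: the vertices can be placed in convex position (cyclic order given
-- by an injective position map π) so that no two edges cross as chords,
-- i.e. there are no edges ab, cd with π a < π c < π b < π d.
Outerplanar : ∀ {n} → Graph n → Set
Outerplanar {n} G =
  Σ (Fin n → Fin n) λ π → Injective _≡_ _≡_ π ×
    (∀ a b c d → adj G a b ≡ true → adj G c d ≡ true →
       toℕ (π a) < toℕ (π c) → toℕ (π c) < toℕ (π b) → toℕ (π b) < toℕ (π d) → ⊥)

{-# OPTIONS --safe #-}
module Submission where

-- Read the vertex order of the outerplanar drawing cyclically. By 2-connectivity
-- cyclically consecutive vertices are adjacent, so every other edge is a chord. A chord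
-- xy with at least two vertices on each side, together with the cycle neighbours of x
-- and of y, is an S₂,₂; hence every chord joins vertices at cyclic distance two. For
-- consecutive vertices u, v this leaves four possible chords, two at u and two at v, and
-- any two of them cross or span an S₂,₂, so deg u + deg v ≤ 5. Summing over the n
-- consecutive pairs gives 4 |E| = 2 Σ deg ≤ 5 n. Each local statement is proved after
-- rotating the drawing so that the vertices involved sit at fixed small positions.

open import Defs hiding (sym)
open import Data.Nat
open import Data.Nat.Properties
open import Data.Nat.DivMod
open import Data.Nat.Tactic.RingSolver using (solve-∀)
open import Data.Nat.ListAction using () renaming (sum to sumˡ)
open import Data.Bool using (Bool; true; false; if_then_else_; _∧_; T)
open import Data.Bool.Properties using (∧-zeroʳ; ¬-not)
open import Data.Fin as F using (Fin; zero; suc; toℕ)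
open import Data.Fin.Patterns using (0F; 1F; 2F; 3F; 4F; 5F)
import Data.Fin.Properties as FP
open import Data.Fin.Permutation using (Permutation′; permutation; _⟨$⟩ˡ_; inverseʳ)
open import Data.List as List using (allFin; tabulate)
open import Data.List.Properties using (map-tabulate)
open import Data.Vec as Vec using (Vec; []; _∷_; lookup)
open import Data.Vec.Relation.Unary.All using (All; []; _∷_)
open import Data.Vec.Relation.Unary.AllPairs using (AllPairs; []; _∷_; allPairs?)
open import Data.Vec.Relation.Unary.Linked using (Linked; _∷_; [-])
import Data.Vec.Relation.Unary.Linked.Properties as Linked
open import Data.Vec.Relation.Unary.Unique.Propositional using (Unique)
open import Data.Vec.Relation.Unary.Unique.Propositional.Properties using (lookup-injective)
open import Data.Product using (∃; ∃₂; _×_; _,_; proj₁; proj₂)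
open import Data.Sum using (_⊎_; inj₁; inj₂)
open import Data.Empty using (⊥; ⊥-elim)
open import Function using (_∘_; id)
open import Function.Definitions using (Injective)
open import Relation.Binary using (tri<; tri≈; tri>)
open import Relation.Binary.PropositionalEquality
open import Relation.Nullary using (Dec; does; yes; no; ¬_; ¬?; contradiction)
open import Relation.Nullary.Decidable using (True; toWitness; dec-true)
open import Relation.Unary using (Decidable)
open import Algebra.Properties.CommutativeMonoid.Sum +-0-commutativeMonoid
  using (sum; ∑-comm; ∑-distrib-+; sum-cong-≗; sum-replicate-zero; sum-permute)

sum-mono : ∀ {m} {f g : Fin m → ℕ} → (∀ i → f i ≤ g i) → sum f ≤ sum g
sum-mono {zero}  f≤g = z≤n
sum-mono {suc m} f≤g = +-mono-≤ (f≤g zero) (sum-mono (f≤g ∘ suc))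

term≤sum : ∀ {m} (f : Fin m → ℕ) i → f i ≤ sum f
term≤sum f zero    = m≤m+n _ _
term≤sum f (suc i) = ≤-trans (term≤sum (f ∘ suc) i) (m≤n+m _ _)

sum-const : ∀ m c → sum {m} (λ _ → c) ≡ m * c
sum-const zero    c = refl
sum-const (suc m) c = cong (c +_) (sum-const m c)

select : ∀ {m} → Fin m → (Fin m → ℕ) → Fin m → ℕ
select i f j = if does (j F.≟ i) then f j else 0

select-self : ∀ {m} (i : Fin m) f → select i f i ≡ f i
select-self i f = cong (if_then f i else 0) (dec-true (i F.≟ i) refl)

sum-select : ∀ {m} (i : Fin m) f → sum (select i f) ≡ f i
sum-select {suc m} zero    f = trans (cong (f zero +_) (sum-replicate-zero m)) (+-identityʳ (f zero))
sum-select {suc m} (suc i) f = sum-select i (f ∘ suc)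

sum-≤-sum-cover : ∀ {m k} (f : Fin m → ℕ) (s : Fin k → Fin m) →
                  (∀ i → f i ≢ 0 → ∃ λ j → s j ≡ i) → sum f ≤ sum (f ∘ s)
sum-≤-sum-cover f s cover = begin
  sum f                                    ≤⟨ sum-mono covered ⟩
  sum (λ i → sum (λ j → select (s j) f i)) ≡⟨ ∑-comm (λ i j → select (s j) f i) ⟩
  sum (λ j → sum (select (s j) f))         ≡⟨ sum-cong-≗ (λ j → sum-select (s j) f) ⟩
  sum (f ∘ s)                              ∎
  where
  open ≤-Reasoning
  covered : ∀ i → f i ≤ sum (λ j → select (s j) f i)
  covered i with f i ≟ 0
  ... | yes fi≡0 = ≤-trans (≤-reflexive fi≡0) z≤n
  ... | no fi≢0 with j , refl ← cover i fi≢0 =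
    ≤-trans (≤-reflexive (sym (select-self (s j) f))) (term≤sum (λ j′ → select (s j′) f (s j)) j)

sum-allFin : ∀ {m} (f : Fin m → ℕ) → sumˡ (List.map f (allFin m)) ≡ sum f
sum-allFin {m} f = trans (cong sumˡ (map-tabulate id f)) (sum-tabulate f)
  where
  sum-tabulate : ∀ {m} (f : Fin m → ℕ) → sumˡ (tabulate f) ≡ sum f
  sum-tabulate {zero}  f = refl
  sum-tabulate {suc m} f = cong (f zero +_) (sum-tabulate (f ∘ suc))

injective⇒surjective : ∀ {m} {f : Fin m → Fin m} → Injective _≡_ _≡_ f → ∀ y → ∃ λ x → f x ≡ y
injective⇒surjective {suc m} {f} f-inj y with FP.any? (λ x → f x F.≟ y)
... | yes hit = hit
... | no miss = ⊥-elim (<-irrefl refl (FP.injective⇒≤ punchOut∘f-injective))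
  where
  y≢f : ∀ x → y ≢ f x
  y≢f x y≡fx = miss (x , sym y≡fx)
  punchOut∘f-injective : Injective _≡_ _≡_ (λ x → F.punchOut (y≢f x))
  punchOut∘f-injective {a} {b} eq = f-inj (FP.punchOut-injective (y≢f a) (y≢f b) eq)

injective⇒permutation : ∀ {m} {f : Fin m → Fin m} → Injective _≡_ _≡_ f → Permutation′ m
injective⇒permutation {f = f} f-inj =
  permutation f (proj₁ ∘ surj) (proj₂ ∘ surj) (λ x → f-inj (proj₂ (surj (f x))))
  where
  surj : ∀ y → ∃ λ x → f x ≡ y
  surj = injective⇒surjective f-inj

bit : Bool → ℕ
bit b = if b then 1 else 0

bit≤1 : ∀ b → bit b ≤ 1
bit≤1 true  = ≤-refl
bit≤1 false = z≤n

Exclusive : Bool → Bool → Set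
Exclusive a b = a ≡ true → b ≡ true → ⊥

exclusive⇒count≤1 : ∀ {m} {bs : Vec Bool m} → AllPairs Exclusive bs → Vec.sum (Vec.map bit bs) ≤ 1
exclusive⇒count≤1 {bs = []}         []           = z≤n
exclusive⇒count≤1 {bs = false ∷ bs} (_ ∷ rest)   = exclusive⇒count≤1 rest
exclusive⇒count≤1 {bs = true ∷ bs}  (others ∷ _) = ≤-reflexive (cong suc (others-false others))
  where
  others-false : ∀ {m} {bs : Vec Bool m} → All (Exclusive true) bs → Vec.sum (Vec.map bit bs) ≡ 0
  others-false {bs = []}         []           = refl
  others-false {bs = false ∷ bs} (_ ∷ rest)   = others-false rest
  others-false {bs = true ∷ bs}  (excl ∷ _)   = ⊥-elim (excl refl refl)

sorted⇒lookup-injective : ∀ {A : Set} {m} {f : A → ℕ} {ws : Vec A m} →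
                          Linked (λ u v → f u < f v) ws → Injective _≡_ _≡_ (lookup ws)
sorted⇒lookup-injective {f = f} sorted {i} {j} eq with FP.<-cmp i j
... | tri< i<j _ _ = ⊥-elim (<-irrefl (cong f eq) (Linked.lookup⁺ <-trans sorted i<j))
... | tri≈ _ i≡j _ = i≡j
... | tri> _ _ j<i = ⊥-elim (<-irrefl (cong f (sym eq)) (Linked.lookup⁺ <-trans sorted j<i))

unique? : ∀ {k m} (ρ : Vec (Fin k) m) → Dec (Unique ρ)
unique? = allPairs? (λ i j → ¬? (i F.≟ j))

[m%n+k]%n≡[m+k]%n : ∀ m k n .{{_ : NonZero n}} → (m % n + k) % n ≡ (m + k) % n
[m%n+k]%n≡[m+k]%n m k n = begin
  (m % n + k) % n          ≡⟨ %-distribˡ-+ (m % n) k n ⟩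
  (m % n % n + k % n) % n  ≡⟨ cong (λ r → (r + k % n) % n) (m%n%n≡m%n m n) ⟩
  (m % n + k % n) % n      ≡⟨ %-distribˡ-+ m k n ⟨
  (m + k) % n              ∎
  where open ≡-Reasoning

module _ {n} .{{_ : NonZero n}} where

  sucMod : Fin n → Fin n
  sucMod i = F.fromℕ< (m%n<n (suc (toℕ i)) n)

  toℕ-sucMod : ∀ i → toℕ (sucMod i) ≡ suc (toℕ i) % n
  toℕ-sucMod i = FP.toℕ-fromℕ< (m%n<n (suc (toℕ i)) n)

  sucMod-cases : ∀ i → toℕ (sucMod i) ≡ suc (toℕ i) ⊎ (suc (toℕ i) ≡ n × toℕ (sucMod i) ≡ 0)
  sucMod-cases i with m≤n⇒m<n∨m≡n (FP.toℕ<n i)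
  ... | inj₁ i+1<n = inj₁ (trans (toℕ-sucMod i) (m<n⇒m%n≡m i+1<n))
  ... | inj₂ i+1≡n = inj₂ (i+1≡n , trans (toℕ-sucMod i) (trans (cong (_% n) i+1≡n) (n%n≡0 n)))

  sucMod-positive : ∀ i → 0 < toℕ (sucMod i) → toℕ (sucMod i) ≡ suc (toℕ i)
  sucMod-positive i 0<i+1 with sucMod-cases i
  ... | inj₁ no-wrap     = no-wrap
  ... | inj₂ (_ , wraps) = contradiction wraps (>⇒≢ 0<i+1)

  sucMod-injective : Injective _≡_ _≡_ sucMod
  sucMod-injective {i} {j} eq with sucMod-cases i | sucMod-cases j | cong toℕ eq
  ... | inj₁ i↦ | inj₁ j↦ | eq′ = FP.toℕ-injective (suc-injective (trans (sym i↦) (trans eq′ j↦)))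
  ... | inj₂ (i-last , _) | inj₂ (j-last , _) | _ = FP.toℕ-injective (suc-injective (trans i-last (sym j-last)))
  ... | inj₁ i↦ | inj₂ (_ , j↦0) | eq′ with () ← trans (sym i↦) (trans eq′ j↦0)
  ... | inj₂ (_ , i↦0) | inj₁ j↦ | eq′ with () ← trans (sym j↦) (trans (sym eq′) i↦0)

module _ {n} (G : Graph n) where

  infix 4 _~_
  _~_ : Fin n → Fin n → Set
  x ~ y = adj G x y ≡ true

  ~-sym : ∀ {x y} → x ~ y → y ~ x
  ~-sym {x} {y} x~y = trans (Graph.sym G y x) x~y

  ~-irrefl : ∀ {x y} → x ~ y → x ≢ y
  ~-irrefl {x} x~x refl with () ← trans (sym x~x) (irrefl G x)

  degree : Fin n → ℕ
  degree x = sum (λ y → bit (adj G x y))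

  handshake : 2 * edgeCount G ≤ sum degree
  handshake = begin
    2 * edgeCount G                            ≡⟨ cong (2 *_) edgeCount≡ ⟩
    2 * E                                      ≡⟨ cong (E +_) (trans (+-identityʳ E) (∑-comm e)) ⟩
    E + sum (λ i → sum (λ j → e j i))          ≡⟨ ∑-distrib-+ (λ i → sum (e i)) (λ i → sum (λ j → e j i)) ⟨
    sum (λ i → sum (e i) + sum (λ j → e j i))  ≡⟨ sum-cong-≗ (λ i → sym (∑-distrib-+ (e i) (λ j → e j i))) ⟩
    sum (λ i → sum (λ j → e i j + e j i))      ≤⟨ sum-mono (λ i → sum-mono (e+e≤bit i)) ⟩
    sum degree                                 ∎
    where
    open ≤-Reasoning
    e : Fin n → Fin n → ℕ
    e i j = if (toℕ i <ᵇ toℕ j) ∧ adj G i j then 1 else 0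
    E : ℕ
    E = sum (λ i → sum (e i))
    edgeCount≡ : edgeCount G ≡ E
    edgeCount≡ = trans (sum-allFin (λ i → sumˡ (List.map (e i) (allFin n)))) (sum-cong-≗ (λ i → sum-allFin (e i)))
    e+e≤bit : ∀ i j → e i j + e j i ≤ bit (adj G i j)
    e+e≤bit i j rewrite Graph.sym G j i with adj G i j | toℕ i <ᵇ toℕ j in i<j | toℕ j <ᵇ toℕ i in j<i
    ... | false | a     | b     rewrite ∧-zeroʳ a | ∧-zeroʳ b = z≤n
    ... | true  | true  | true  =
      ⊥-elim (<-asym (<ᵇ⇒< (toℕ i) (toℕ j) (subst T (sym i<j) _)) (<ᵇ⇒< (toℕ j) (toℕ i) (subst T (sym j<i) _)))
    ... | true  | true  | false = ≤-refl
    ... | true  | false | true  = ≤-refl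
    ... | true  | false | false = z≤n

  bit-absent : ∀ {x y} → ¬ x ~ y → bit (adj G x y) ≡ 0
  bit-absent ¬x~y = cong bit (¬-not ¬x~y)

  degree-≤-cover : ∀ {k} x (s : Fin k → Fin n) → (∀ y → x ~ y → ∃ λ j → s j ≡ y) →
                   degree x ≤ sum (λ j → bit (adj G x (s j)))
  degree-≤-cover x s cover = sum-≤-sum-cover _ s adjacent-covered
    where
    adjacent-covered : ∀ y → bit (adj G x y) ≢ 0 → ∃ λ j → s j ≡ y
    adjacent-covered y bit≢0 with adj G x y in x~y
    ... | true  = cover y x~y
    ... | false = ⊥-elim (bit≢0 refl)

  boundary-edge : ∀ {P S : Fin n → Set} → Decidable S → ∀ {u v} → Reach G P u v → S u → ¬ S v →
                  ∃₂ λ x y → x ~ y × S x × ¬ S y × P y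
  boundary-edge S? here                        Su ¬Sv = ⊥-elim (¬Sv Su)
  boundary-edge S? (step {u} {w} u~w Pw walk) Su ¬Sv with S? w
  ... | yes Sw = boundary-edge S? walk Sw ¬Sv
  ... | no ¬Sw = u , w , u~w , Su , ¬Sw , Pw

  S22On : (Fin 6 → Fin n) → Set
  S22On v = v 0F ~ v 1F × v 0F ~ v 2F × v 0F ~ v 3F × v 1F ~ v 4F × v 1F ~ v 5F

  -- ρ lists indices into w in the order of ContainsS22: the two centres, then two leaves of each.
  s22-pattern : ∀ {w : Fin 6 → Fin n} → Injective _≡_ _≡_ w →
                (ρ : Vec (Fin 6) 6) {_ : True (unique? ρ)} → S22On (w ∘ lookup ρ) → ContainsS22 G
  s22-pattern {w} w-injective ρ {distinct} edges =
    w ∘ lookup ρ , (λ eq → lookup-injective (toWitness distinct) _ _ (w-injective eq)) , edges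

  NonCrossing : (Fin n → Fin n) → Set
  NonCrossing π = ∀ a b c d → a ~ b → c ~ d →
    toℕ (π a) < toℕ (π c) → toℕ (π c) < toℕ (π b) → toℕ (π b) < toℕ (π d) → ⊥

  module Layout (L : Outerplanar G) where

    pos : Fin n → ℕ
    pos x = toℕ (proj₁ L x)

    pos<n : ∀ x → pos x < n
    pos<n x = FP.toℕ<n (proj₁ L x)

    pos-injective : ∀ {x y} → pos x ≡ pos y → x ≡ y
    pos-injective eq = proj₁ (proj₂ L) (FP.toℕ-injective eq)

    noncrossing : NonCrossing (proj₁ L)
    noncrossing = proj₂ (proj₂ L)

    vertexAt : ∀ k → .(k < n) → Fin n
    vertexAt k k<n = injective⇒permutation (proj₁ (proj₂ L)) ⟨$⟩ˡ F.fromℕ< k<n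

    pos-vertexAt : ∀ k .(k<n : k < n) → pos (vertexAt k k<n) ≡ k
    pos-vertexAt k k<n = trans (cong toℕ (inverseʳ (injective⇒permutation (proj₁ (proj₂ L))))) (FP.toℕ-fromℕ< k<n)

    pos-< : ∀ {u v i j} → pos u ≡ i → pos v ≡ j → i < j → pos u < pos v
    pos-< u-at v-at = subst₂ _<_ (sym u-at) (sym v-at)

  module _ {{_ : NonZero n}} where

    -- After the shift only a can have wrapped around to 0, and then c, b, d, a cross before it.
    sucMod-noncrossing : ∀ {π} → NonCrossing π → NonCrossing (sucMod ∘ π)
    sucMod-noncrossing {π} nc a b c d a~b c~d ac cb bd = by-position-of-a (sucMod-cases (π a))
      where
      Shifted : Fin n → Set
      Shifted x = toℕ (sucMod (π x)) ≡ suc (toℕ (π x))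
      unshift : ∀ {x y} → Shifted x → Shifted y →
                toℕ (sucMod (π x)) < toℕ (sucMod (π y)) → toℕ (π x) < toℕ (π y)
      unshift x↦ y↦ lt = s<s⁻¹ (subst₂ _<_ x↦ y↦ lt)
      c↦ : Shifted c
      c↦ = sucMod-positive (π c) (≤-trans (s≤s z≤n) ac)
      b↦ : Shifted b
      b↦ = sucMod-positive (π b) (≤-trans (s≤s z≤n) cb)
      d↦ : Shifted d
      d↦ = sucMod-positive (π d) (≤-trans (s≤s z≤n) bd)
      by-position-of-a : Shifted a ⊎ (suc (toℕ (π a)) ≡ n × toℕ (sucMod (π a)) ≡ 0) → ⊥
      by-position-of-a (inj₁ a↦) = nc a b c d a~b c~d (unshift a↦ c↦ ac) (unshift c↦ b↦ cb) (unshift b↦ d↦ bd)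
      by-position-of-a (inj₂ (a-last , _)) =
        nc c d b a c~d (~-sym a~b) (unshift c↦ b↦ cb) (unshift b↦ d↦ bd)
           (s<s⁻¹ (subst₂ _<_ d↦ (sym a-last) (FP.toℕ<n (sucMod (π d)))))

    rotate : Outerplanar G → Outerplanar G
    rotate (π , π-injective , π-noncrossing) =
      sucMod ∘ π , π-injective ∘ sucMod-injective , sucMod-noncrossing π-noncrossing

    rotateBy : ℕ → Outerplanar G → Outerplanar G
    rotateBy zero    L = L
    rotateBy (suc k) L = rotateBy k (rotate L)

    pos-rotateBy : ∀ k L x → Layout.pos (rotateBy k L) x ≡ (Layout.pos L x + k) % n
    pos-rotateBy zero L x = sym (trans (cong (_% n) (+-identityʳ (pos x))) (m<n⇒m%n≡m (pos<n x)))
      where open Layout L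
    pos-rotateBy (suc k) L x = begin
      Layout.pos (rotateBy k (rotate L)) x   ≡⟨ pos-rotateBy k (rotate L) x ⟩
      (toℕ (sucMod (proj₁ L x)) + k) % n     ≡⟨ cong (λ r → (r + k) % n) (toℕ-sucMod (proj₁ L x)) ⟩
      (suc (pos x) % n + k) % n              ≡⟨ [m%n+k]%n≡[m+k]%n (suc (pos x)) k n ⟩
      (suc (pos x) + k) % n                  ≡⟨ cong (_% n) (+-suc (pos x) k) ⟨
      (pos x + suc k) % n                    ∎
      where open Layout L
            open ≡-Reasoning

    rotateTo : Outerplanar G → Fin n → ℕ → Outerplanar G
    rotateTo L x t = rotateBy (n ∸ Layout.pos L x + t) L

    pos-rotateTo : ∀ L {x y} t d → Layout.pos L y ≡ (Layout.pos L x + d) % n →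
                   Layout.pos (rotateTo L x t) y ≡ (t + d) % n
    pos-rotateTo L {x} {y} t d y-at-d = begin
      Layout.pos (rotateTo L x t) y             ≡⟨ pos-rotateBy (n ∸ pos x + t) L y ⟩
      (pos y + (n ∸ pos x + t)) % n             ≡⟨ cong (λ r → (r + (n ∸ pos x + t)) % n) y-at-d ⟩
      ((pos x + d) % n + (n ∸ pos x + t)) % n   ≡⟨ [m%n+k]%n≡[m+k]%n (pos x + d) (n ∸ pos x + t) n ⟩
      (pos x + d + (n ∸ pos x + t)) % n         ≡⟨ cong (_% n) (+-rearrange (pos x) d (n ∸ pos x) t) ⟩
      (t + d + (pos x + (n ∸ pos x))) % n       ≡⟨ cong (λ r → (t + d + r) % n) (m+[n∸m]≡n (<⇒≤ (pos<n x))) ⟩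
      (t + d + n) % n                           ≡⟨ [m+n]%n≡m%n (t + d) n ⟩
      (t + d) % n                               ∎
      where
      open Layout L
      open ≡-Reasoning
      +-rearrange : ∀ a d b t → a + d + (b + t) ≡ t + d + (a + b)
      +-rearrange = solve-∀

    pos-rotateTo-self : ∀ L x t → Layout.pos (rotateTo L x t) x ≡ t % n
    pos-rotateTo-self L x t = trans (pos-rotateTo L t 0 (pos-rotateBy 0 L x)) (cong (_% n) (+-identityʳ t))

    next : Outerplanar G → Fin n → Fin n
    next L v = Layout.vertexAt L (toℕ (sucMod (proj₁ L v))) (FP.toℕ<n (sucMod (proj₁ L v)))

    pos-next : ∀ L v → Layout.pos L (next L v) ≡ suc (Layout.pos L v) % n
    pos-next L v = trans (Layout.pos-vertexAt L _ _) (toℕ-sucMod (proj₁ L v))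

    next-injective : ∀ L → Injective _≡_ _≡_ (next L)
    next-injective L eq =
      proj₁ (proj₂ L) (sucMod-injective (FP.toℕ-injective
        (trans (sym (pos-vertexAt _ _)) (trans (cong pos eq) (pos-vertexAt _ _)))))
      where open Layout L

    module _ (two-connected : TwoConnected G) where

      -- Let b be a neighbour of x before y. A walk from y to x avoiding b jumps from beyond b
      -- to before b; the jump cannot cross the chord xb, so it lands on x: x has a farther neighbour.
      first~last : ∀ L {x y} → Layout.pos L x ≡ 0 → suc (Layout.pos L y) ≡ n → x ~ y
      first~last L {x} {y} x-first y-last =
        neighbour-reaches-last n (proj₂ first-neighbour) (m∸n≤m n (pos (proj₁ first-neighbour)))
        where
        open Layout L

        y≢x : y ≢ x
        y≢x refl = <⇒≢ (≤-trans (s≤s (s≤s z≤n)) (proj₁ two-connected)) (trans (cong suc (sym x-first)) y-last)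

        first-neighbour : ∃ λ b → x ~ b
        first-neighbour with boundary-edge (F._≟ x) (proj₁ (proj₂ two-connected) x y) refl y≢x
        ... | _ , w , x~w , refl , _ = w , x~w

        farther-neighbour : ∀ {b} → x ~ b → suc (pos b) < n → ∃ λ c → x ~ c × pos b < pos c
        farther-neighbour {b} x~b b<last =
          beyond (boundary-edge (λ v → pos b <? pos v)
                                (proj₂ (proj₂ two-connected) b y x y≢b (~-irrefl x~b)) b<y b≮x)
          where
          b<y : pos b < pos y
          b<y = s<s⁻¹ (subst (suc (pos b) <_) (sym y-last) b<last)
          y≢b : y ≢ b
          y≢b refl = <-irrefl refl b<y
          b≮x : ¬ (pos b < pos x)
          b≮x b<x = n≮0 (subst (pos b <_) x-first b<x)
          beyond : (∃₂ λ u w → u ~ w × pos b < pos u × ¬ (pos b < pos w) × w ≢ b) →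
                   ∃ λ c → x ~ c × pos b < pos c
          beyond (u , w , u~w , b<u , b≮w , w≢b) with pos w ≟ 0
          ... | yes w-first = u , subst (_~ u) (pos-injective (trans w-first (sym x-first))) (~-sym u~w) , b<u
          ... | no  w≢first = ⊥-elim (noncrossing x b w u x~b (~-sym u~w)
                                (subst (_< pos w) (sym x-first) (n≢0⇒n>0 w≢first))
                                (≤∧≢⇒< (≮⇒≥ b≮w) (w≢b ∘ pos-injective)) b<u)

        neighbour-reaches-last : ∀ fuel {b} → x ~ b → n ∸ pos b ≤ fuel → x ~ y
        neighbour-reaches-last fuel {b} x~b bound with suc (pos b) <? n
        ... | no b-last =
          subst (x ~_) (pos-injective (suc-injective (trans (≤-antisym (pos<n b) (≮⇒≥ b-last)) (sym y-last)))) x~b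
        ... | yes b<last with farther-neighbour x~b b<last | fuel
        ...   | _ , _ , _ | zero = ⊥-elim (<⇒≱ (m<n⇒0<n∸m (pos<n b)) bound)
        ...   | c , x~c , b<c | suc fuel′ =
          neighbour-reaches-last fuel′ x~c (s≤s⁻¹ (<-≤-trans (∸-monoʳ-< b<c (<⇒≤ (pos<n c))) bound))

      cycle-edge : ∀ L {x y} → Layout.pos L y ≡ suc (Layout.pos L x) % n → x ~ y
      cycle-edge L {x} {y} y-next = ~-sym (first~last (rotateTo L x (pred n)) y-first x-last)
        where
        open Layout L
        open ≡-Reasoning
        x-last : suc (Layout.pos (rotateTo L x (pred n)) x) ≡ n
        x-last = trans (cong suc (trans (pos-rotateTo-self L x (pred n)) (m<n⇒m%n≡m (≤-reflexive (suc-pred n)))))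
                       (suc-pred n)
        y-first : Layout.pos (rotateTo L x (pred n)) y ≡ 0
        y-first = begin
          Layout.pos (rotateTo L x (pred n)) y
            ≡⟨ pos-rotateTo L (pred n) 1 (trans y-next (cong (_% n) (+-comm 1 (pos x)))) ⟩
          (pred n + 1) % n                       ≡⟨ cong (_% n) (trans (+-comm (pred n) 1) (suc-pred n)) ⟩
          n % n                                  ≡⟨ n%n≡0 n ⟩
          0                                      ∎

      consecutive-edge : ∀ L {x y i} → Layout.pos L x ≡ i → Layout.pos L y ≡ suc i → x ~ y
      consecutive-edge L {x} {y} x-at y-at =
        cycle-edge L (trans y-at (sym (trans (cong (λ p → suc p % n) x-at) (m<n⇒m%n≡m (subst (_< n) y-at (pos<n y))))))
        where open Layout L

      module _ (s22-free : S22Free G) where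

        chord-from-second : ∀ L {x y} e → Layout.pos L x ≡ 1 → Layout.pos L y ≡ 4 + e → 6 + e ≤ n →
                            x ~ y → ⊥
        chord-from-second L {x} {y} e x-at y-at e+6≤n x~y =
          s22-free (s22-pattern (sorted⇒lookup-injective sorted) (1F ∷ 4F ∷ 0F ∷ 2F ∷ 3F ∷ 5F ∷ [])
                                (x~y , ~-sym (edge x⁻-at x-at) , edge x-at x⁺-at ,
                                 ~-sym (edge y⁻-at y-at) , edge y-at y⁺-at))
          where
          open Layout L
          edge : ∀ {u v i} → pos u ≡ i → pos v ≡ suc i → u ~ v
          edge = consecutive-edge L
          <n : ∀ k → k ≤ 5 + e → k < n
          <n k k≤ = ≤-trans (s≤s k≤) e+6≤n
          x⁻ x⁺ y⁻ y⁺ : Fin n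
          x⁻ = vertexAt 0 (<n 0 z≤n)
          x⁺ = vertexAt 2 (<n 2 (s≤s (s≤s z≤n)))
          y⁻ = vertexAt (3 + e) (<n (3 + e) (+-monoˡ-≤ e (s≤s (s≤s (s≤s z≤n)))))
          y⁺ = vertexAt (5 + e) (<n (5 + e) ≤-refl)
          x⁻-at : pos x⁻ ≡ 0
          x⁻-at = pos-vertexAt 0 _
          x⁺-at : pos x⁺ ≡ 2
          x⁺-at = pos-vertexAt 2 _
          y⁻-at : pos y⁻ ≡ 3 + e
          y⁻-at = pos-vertexAt (3 + e) _
          y⁺-at : pos y⁺ ≡ 5 + e
          y⁺-at = pos-vertexAt (5 + e) _
          sorted : Linked (λ u v → pos u < pos v) (x⁻ ∷ x ∷ x⁺ ∷ y⁻ ∷ y ∷ y⁺ ∷ [])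
          sorted = pos-< x⁻-at x-at ≤-refl ∷ pos-< x-at x⁺-at ≤-refl ∷
                   pos-< x⁺-at y⁻-at (s≤s (s≤s (s≤s z≤n))) ∷
                   pos-< y⁻-at y-at ≤-refl ∷ pos-< y-at y⁺-at ≤-refl ∷ [-]

        no-long-chord : ∀ L {x y} → x ~ y →
                        Layout.pos L x + 3 ≤ Layout.pos L y → Layout.pos L y + 3 ≤ Layout.pos L x + n → ⊥
        no-long-chord L {x} {y} x~y inner outer with e , x+3+e≡y ← m≤n⇒∃[o]m+o≡n inner =
          chord-from-second (rotateTo L x 1) e x-second y-at e+6≤n x~y
          where
          open Layout L
          +-outer : ∀ a e → a + 3 + e + 3 ≡ a + (6 + e)
          +-outer = solve-∀
          e+6≤n : 6 + e ≤ n
          e+6≤n = +-cancelˡ-≤ (pos x) (6 + e) n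
                    (subst (_≤ pos x + n) (trans (cong (_+ 3) (sym x+3+e≡y)) (+-outer (pos x) e)) outer)
          x-second : Layout.pos (rotateTo L x 1) x ≡ 1
          x-second = trans (pos-rotateTo-self L x 1) (m<n⇒m%n≡m (≤-trans (s≤s (s≤s z≤n)) e+6≤n))
          y-at : Layout.pos (rotateTo L x 1) y ≡ 4 + e
          y-at = trans (pos-rotateTo L 1 (3 + e) (sym (trans (cong (_% n) (trans (sym (+-assoc (pos x) 3 e)) x+3+e≡y))
                                                               (m<n⇒m%n≡m (pos<n y)))))
                       (m<n⇒m%n≡m (≤-trans (+-monoˡ-≤ e (s≤s (s≤s (s≤s (s≤s (s≤s z≤n)))))) e+6≤n))

        module _ (6≤n : 6 ≤ n) where

          module Window (L : Outerplanar G) where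
            open Layout L public

            w : Fin 6 → Fin n
            w i = vertexAt (toℕ i) (<-≤-trans (FP.toℕ<n i) 6≤n)

            pos-w : ∀ i → pos (w i) ≡ toℕ i
            pos-w i = pos-vertexAt (toℕ i) _

            w-injective : Injective _≡_ _≡_ w
            w-injective {i} {j} eq = FP.toℕ-injective (trans (sym (pos-w i)) (trans (cong pos eq) (pos-w j)))

            w-covers : ∀ {y} → pos y < 6 → ∃ λ i → w i ≡ y
            w-covers y<6 = F.fromℕ< y<6 , pos-injective (trans (pos-w _) (FP.toℕ-fromℕ< y<6))

            w-path : ∀ (i : Fin 5) → w (F.inject₁ i) ~ w (suc i)
            w-path i = consecutive-edge L (trans (pos-w (F.inject₁ i)) (FP.toℕ-inject₁ i)) (pos-w (suc i))

            w-crossing : ∀ a b c d → w a ~ w c → w b ~ w d →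
                         toℕ a < toℕ b → toℕ b < toℕ c → toℕ c < toℕ d → ⊥
            w-crossing a b c d a~c b~d a<b b<c c<d =
              noncrossing (w a) (w c) (w b) (w d) a~c b~d
                (pos-< (pos-w a) (pos-w b) a<b) (pos-< (pos-w b) (pos-w c) b<c) (pos-< (pos-w c) (pos-w d) c<d)

            w-long : ∀ i j → w i ~ w j → toℕ i + 3 ≤ toℕ j → toℕ j + 3 ≤ toℕ i + n → ⊥
            w-long i j i~j inner outer =
              no-long-chord L i~j (subst₂ (λ p q → p + 3 ≤ q) (sym (pos-w i)) (sym (pos-w j)) inner)
                                  (subst₂ (λ p q → p + 3 ≤ q + n) (sym (pos-w j)) (sym (pos-w i)) outer)

            w-s22 : (ρ : Vec (Fin 6) 6) {_ : True (unique? ρ)} → S22On (w ∘ lookup ρ) → ⊥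
            w-s22 ρ {distinct} edges = s22-free (s22-pattern w-injective ρ {distinct} edges)

            neighbours-in-window : ∀ i {y} → 2 ≤ toℕ i → toℕ i ≤ 3 → w i ~ y → pos y < 6
            neighbours-in-window i {y} 2≤i i≤3 i~y with pos y <? 6
            ... | yes y<6 = y<6
            ... | no  y≮6 = ⊥-elim (no-long-chord L i~y
                                      (≤-trans (+-monoˡ-≤ 3 (≤-trans (≤-reflexive (pos-w i)) i≤3)) (≮⇒≥ y≮6))
                                      (subst₂ _≤_ (sym (+-suc (pos y) 2)) (+-comm n (pos (w i)))
                                              (+-mono-≤ (pos<n y) (≤-trans 2≤i (≤-reflexive (sym (pos-w i)))))))

            degree-≤-window : ∀ i (bound : Fin 6 → ℕ) → 2 ≤ toℕ i → toℕ i ≤ 3 →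
                              (∀ j → bit (adj G (w i) (w j)) ≤ bound j) → degree (w i) ≤ sum bound
            degree-≤-window i bound 2≤i i≤3 row =
              ≤-trans (degree-≤-cover (w i) w (λ _ i~y → w-covers (neighbours-in-window i 2≤i i≤3 i~y)))
                      (sum-mono row)

            -- The only possible chords at w 2F and w 3F.
            A B C D : Bool
            A = adj G (w 2F) (w 0F)
            B = adj G (w 2F) (w 4F)
            C = adj G (w 3F) (w 1F)
            D = adj G (w 3F) (w 5F)

            row₂ : ∀ i → bit (adj G (w 2F) (w i)) ≤ lookup (bit A ∷ 1 ∷ 0 ∷ 1 ∷ bit B ∷ 0 ∷ []) i
            row₂ 0F = ≤-refl
            row₂ 1F = bit≤1 _
            row₂ 2F = ≤-reflexive (cong bit (irrefl G (w 2F)))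
            row₂ 3F = bit≤1 _
            row₂ 4F = ≤-refl
            row₂ 5F =
              ≤-reflexive (bit-absent (λ 2~5 → w-long 2F 5F 2~5 ≤-refl (+-monoʳ-≤ 2 6≤n)))

            row₃ : ∀ i → bit (adj G (w 3F) (w i)) ≤ lookup (0 ∷ bit C ∷ 1 ∷ 0 ∷ 1 ∷ bit D ∷ []) i
            row₃ 0F =
              ≤-reflexive (bit-absent (λ 3~0 → w-long 0F 3F (~-sym 3~0) ≤-refl 6≤n))
            row₃ 1F = ≤-refl
            row₃ 2F = bit≤1 _
            row₃ 3F = ≤-reflexive (cong bit (irrefl G (w 3F)))
            row₃ 4F = bit≤1 _
            row₃ 5F = ≤-refl

            chords-exclusive : AllPairs Exclusive (A ∷ B ∷ C ∷ D ∷ [])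
            chords-exclusive = (A∧B ∷ A∧C ∷ A∧D ∷ []) ∷ (B∧C ∷ B∧D ∷ []) ∷ (C∧D ∷ []) ∷ [] ∷ []
              where
              A∧B : Exclusive A B
              A∧B a b = w-s22 (2F ∷ 4F ∷ 0F ∷ 1F ∷ 3F ∷ 5F ∷ [])
                              (b , a , ~-sym (w-path 1F) , ~-sym (w-path 3F) , w-path 4F)
              A∧C : Exclusive A C
              A∧C a c = w-crossing 0F 1F 2F 3F (~-sym a) (~-sym c) ≤-refl ≤-refl ≤-refl
              A∧D : Exclusive A D
              A∧D a d = w-s22 (2F ∷ 3F ∷ 0F ∷ 1F ∷ 4F ∷ 5F ∷ [])
                              (w-path 2F , a , ~-sym (w-path 1F) , w-path 3F , d)
              B∧C : Exclusive B C
              B∧C b c = w-crossing 1F 2F 3F 4F (~-sym c) b ≤-refl ≤-refl ≤-refl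
              B∧D : Exclusive B D
              B∧D b d = w-crossing 2F 3F 4F 5F b d ≤-refl ≤-refl ≤-refl
              C∧D : Exclusive C D
              C∧D c d = w-s22 (3F ∷ 1F ∷ 4F ∷ 5F ∷ 0F ∷ 2F ∷ [])
                              (c , w-path 3F , d , ~-sym (w-path 0F) , w-path 1F)

            window-degrees : degree (w 2F) + degree (w 3F) ≤ 5
            window-degrees = begin
              degree (w 2F) + degree (w 3F)
                ≤⟨ +-mono-≤ (degree-≤-window 2F _ ≤-refl (n≤1+n 2) row₂)
                            (degree-≤-window 3F _ (n≤1+n 2) ≤-refl row₃) ⟩
              sum (lookup (bit A ∷ 1 ∷ 0 ∷ 1 ∷ bit B ∷ 0 ∷ [])) +
              sum (lookup (0 ∷ bit C ∷ 1 ∷ 0 ∷ 1 ∷ bit D ∷ []))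
                ≡⟨ +-window (bit A) (bit B) (bit C) (bit D) ⟩
              4 + Vec.sum (Vec.map bit (A ∷ B ∷ C ∷ D ∷ []))
                ≤⟨ +-monoʳ-≤ 4 (exclusive⇒count≤1 chords-exclusive) ⟩
              5 ∎
              where
              open ≤-Reasoning
              +-window : ∀ a b c d → a + (1 + (0 + (1 + (b + (0 + 0))))) + (0 + (c + (1 + (0 + (1 + (d + 0)))))) ≡
                                     4 + (a + (b + (c + (d + 0))))
              +-window = solve-∀

          degree+degree-next≤5 : ∀ L v → degree v + degree (next L v) ≤ 5
          degree+degree-next≤5 L v =
            subst₂ (λ a b → degree a + degree b ≤ 5) v-at-2 next-at-3 (Window.window-degrees (rotateTo L v 2))
            where
            open Window (rotateTo L v 2)
            v-at-2 : w 2F ≡ v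
            v-at-2 = pos-injective (trans (pos-w 2F)
                       (sym (trans (pos-rotateTo-self L v 2) (m<n⇒m%n≡m (≤-trans (s≤s (s≤s (s≤s z≤n))) 6≤n)))))
            next-at-3 : w 3F ≡ next L v
            next-at-3 = pos-injective (trans (pos-w 3F)
                          (sym (trans (pos-rotateTo L 2 1 (trans (pos-next L v) (cong (_% n) (+-comm 1 (Layout.pos L v)))))
                                      (m<n⇒m%n≡m (≤-trans (s≤s (s≤s (s≤s (s≤s z≤n)))) 6≤n)))))

          four-edges≤five-vertices : Outerplanar G → edgeCount G * 4 ≤ 5 * n
          four-edges≤five-vertices L = begin
            edgeCount G * 4                            ≡⟨ *4-double (edgeCount G) ⟩
            2 * edgeCount G + 2 * edgeCount G          ≤⟨ +-mono-≤ handshake handshake ⟩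
            sum degree + sum degree
              ≡⟨ cong (sum degree +_) (sum-permute degree (injective⇒permutation (next-injective L))) ⟩
            sum degree + sum (degree ∘ next L)         ≡⟨ ∑-distrib-+ degree (degree ∘ next L) ⟨
            sum (λ v → degree v + degree (next L v))   ≤⟨ sum-mono (degree+degree-next≤5 L) ⟩
            sum {n} (λ _ → 5)                          ≡⟨ sum-const n 5 ⟩
            n * 5                                      ≡⟨ *-comm n 5 ⟩
            5 * n                                      ∎
            where
            open ≤-Reasoning
            *4-double : ∀ e → e * 4 ≡ 2 * e + 2 * e
            *4-double = solve-∀

lemma8 : (n : ℕ) → (G : Graph n) → 6 ≤ n → TwoConnected G → S22Free G → Outerplanar G →
           edgeCount G ≤ (5 * n) / 4
lemma8 n G 6≤n two-connected s22-free L = begin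
  edgeCount G          ≡⟨ m*n/n≡m (edgeCount G) 4 ⟨
  edgeCount G * 4 / 4  ≤⟨ /-monoˡ-≤ 4 (four-edges≤five-vertices G ⦃ n≢0 ⦄ two-connected s22-free 6≤n L) ⟩
  5 * n / 4            ∎
  where
  open ≤-Reasoning
  n≢0 : NonZero n
  n≢0 = >-nonZero (≤-trans (s≤s z≤n) 6≤n)
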